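{- Let $\sigma\ge2$ be an integer, $\mu=1/\sigma$, and $f_d(\lambda)=\lambda^{d+1}-\lambda^d-\mu^{d+1}+\mu^d$. For all sufficiently large $d$, $f_d$ has a real root $\lambda_0$ with $1-\mu^d<\lambda_0<1-\mu^{d+1}$. -}

module Defs where

open import Data.Nat using (ℕ; zero; suc)
import Data.Nat as ℕ
open import Data.Integer using (+_)
open import Data.Rational using (ℚ; 0ℚ; 1ℚ; _+_; _-_; _*_; _≤_; _<_; ∣_∣; _/_)
open import Data.Product using (∃-syntax; _×_)

_^_ : ℚ → ℕ → ℚ
q ^ zero = 1ℚ
q ^ suc n = q * (q ^ n)

-- μ = 1/σ  (the value at σ = 0 is an irrelevant dummy; the theorem assumes σ ≥ 2)
μ : ℕ → ℚ
μ zero = 0ℚ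
μ (suc k) = + 1 / suc k

f : ℕ → ℕ → ℚ → ℚ
f σ d x = (((x ^ suc d) - (x ^ d)) - (μ σ ^ suc d)) + (μ σ ^ d)

inv : ℕ → ℚ
inv n = + 1 / suc n

-- Constructive (Bishop) real numbers: regular Cauchy sequences of rationals,
-- |x_m - x_n| ≤ 1/(m+1) + 1/(n+1).  Hence |x_n - x| ≤ 1/(n+1).
record ℝ : Set where
  field
    seq : ℕ → ℚ
    reg : ∀ m n → ∣ seq m - seq n ∣ ≤ inv m + inv n
open ℝ public

_<ᴿ_ : ℚ → ℝ → Set
a <ᴿ x = ∃[ n ] (inv n < seq x n - a)

_ᴿ<_ : ℝ → ℚ → Set
x ᴿ< b = ∃[ n ] (inv n < b - seq x n)

-- x is a root of the (polynomial, hence continuous) function g : ℚ → ℚ,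
-- i.e. g(x) = lim g(x_n) = 0.
IsRoot : (ℚ → ℚ) → ℝ → Set
IsRoot g x = ∀ k → ∃[ N ] (∀ n → N ℕ.≤ n → ∣ g (seq x n) ∣ ≤ inv k)

module Submission where

-- Idea: with t = mᵈ, the rationals A = 1 - (1 - m/2) t and B = 1 - (m t + m²t²)
-- satisfy 1 - t < A ≤ B < 1 - m t, f(A) ≤ 0 (Bernoulli's inequality plus the
-- smallness d mᵈ ≤ m/2, valid for d ≥ 4) and f(B) ≥ 0 (since Bᵈ ≤ B).  Bisection on
-- [A, B] then yields a regular Cauchy sequence in [A, B] along which f → 0.

open import Defs
open import Data.Nat using (ℕ; zero; suc; z≤n; s≤s; _≤′_; ≤′-refl; ≤′-step)
import Data.Nat as ℕ
import Data.Nat.Properties as ℕP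
open import Data.Integer as ℤ using (+_; +[1+_])
import Data.Integer.Properties as ℤP
open import Data.Rational
  using (ℚ; 0ℚ; 1ℚ; ½; _+_; _*_; -_; _-_; _<_; _≤_; ∣_∣; mkℚ; toℚᵘ; *<*; *≤*;
         nonNegative; positive; _≤?_)
open import Data.Rational.Properties
import Data.Rational.Unnormalised as ℚᵘ
import Data.Rational.Unnormalised.Properties as ℚᵘP
open import Algebra.Bundles using (CommutativeRing)
open import Algebra.Properties.Semiring.Mult (CommutativeRing.semiring +-*-commutativeRing)
  using (×-comm-*; ×-homo-+; ×-assocˡ) renaming (_×_ to _·_)
open import Data.Product using (∃-syntax; _×_; _,_; proj₁; proj₂)
open import Data.Sum using (inj₁; inj₂)
open import Relation.Binary.PropositionalEquality
open import Relation.Nullary using (yes; no)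
open import Data.Empty using (⊥-elim)
open import Relation.Nullary.Decidable using (dec⇒maybe)
open import Level using (0ℓ)
open import Tactic.RingSolver using (solve-∀)
open import Tactic.RingSolver.Core.AlmostCommutativeRing using (AlmostCommutativeRing; fromCommutativeRing)

ℚ-ring : AlmostCommutativeRing 0ℓ 0ℓ
ℚ-ring = fromCommutativeRing +-*-commutativeRing (λ x → dec⇒maybe (0ℚ ≟ x))

≤-by : ∀ {p q} r → q - p ≡ r → 0ℚ ≤ r → p ≤ q
≤-by {p} {q} r q-p≡r 0≤r =
  subst₂ _≤_ (+-identityʳ p) (p+[q-p]≡q p q) (+-monoʳ-≤ p (subst (0ℚ ≤_) (sym q-p≡r) 0≤r))
  where
  p+[q-p]≡q : ∀ p q → p + (q - p) ≡ q
  p+[q-p]≡q = solve-∀ ℚ-ring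

0≤q-p : ∀ {p q} → p ≤ q → 0ℚ ≤ q - p
0≤q-p {p} {q} p≤q = subst₂ _≤_ (+-inverseʳ p) refl (+-monoˡ-≤ (- p) p≤q)

0≤+ : ∀ {p q} → 0ℚ ≤ p → 0ℚ ≤ q → 0ℚ ≤ p + q
0≤+ = +-mono-≤

0≤* : ∀ {p q} → 0ℚ ≤ p → 0ℚ ≤ q → 0ℚ ≤ p * q
0≤* {p} {q} 0≤p 0≤q =
  nonNegative⁻¹ (p * q) {{nonNeg*nonNeg⇒nonNeg p {{nonNegative 0≤p}} q {{nonNegative 0≤q}}}}

0<* : ∀ {p q} → 0ℚ < p → 0ℚ < q → 0ℚ < p * q
0<* {p} {q} 0<p 0<q = positive⁻¹ (p * q) {{pos*pos⇒pos p {{positive 0<p}} q {{positive 0<q}}}}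

*-monoˡ : ∀ {r p q} → 0ℚ ≤ r → p ≤ q → r * p ≤ r * q
*-monoˡ {r} 0≤r = *-monoˡ-≤-nonNeg r {{nonNegative 0≤r}}

p≤p+q : ∀ {p q} → 0ℚ ≤ q → p ≤ p + q
p≤p+q {p} {q} = ≤-by q (p+q-p≡q p q)
  where
  p+q-p≡q : ∀ p q → (p + q) - p ≡ q
  p+q-p≡q = solve-∀ ℚ-ring

p≤q+p : ∀ {p q} → 0ℚ ≤ q → p ≤ q + p
p≤q+p {p} {q} 0≤q = subst (p ≤_) (+-comm p q) (p≤p+q 0≤q)

p-q≤p : ∀ {p q} → 0ℚ ≤ q → p - q ≤ p
p-q≤p {p} {q} = ≤-by q (p-[p-q]≡q p q)
  where
  p-[p-q]≡q : ∀ p q → p - (p - q) ≡ q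
  p-[p-q]≡q = solve-∀ ℚ-ring

0<1 : 0ℚ < 1ℚ
0<1 = *<* (ℤ.+<+ (s≤s z≤n))

0≤1 : 0ℚ ≤ 1ℚ
0≤1 = <⇒≤ 0<1

0≤½ : 0ℚ ≤ ½
0≤½ = *≤* (ℤ.+≤+ z≤n)

dist-ordered : ∀ {p q} → p ≤ q → ∣ p - q ∣ ≡ q - p
dist-ordered {p} {q} p≤q = begin
  ∣ p - q ∣       ≡⟨ cong ∣_∣ (p-q≡-[q-p] p q) ⟩
  ∣ - (q - p) ∣   ≡⟨ ∣-p∣≡∣p∣ (q - p) ⟩
  ∣ q - p ∣       ≡⟨ 0≤p⇒∣p∣≡p (0≤q-p p≤q) ⟩
  q - p           ∎
  where
  open ≡-Reasoning
  p-q≡-[q-p] : ∀ p q → p - q ≡ - (q - p)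
  p-q≡-[q-p] = solve-∀ ℚ-ring

·-nonneg : ∀ n {x} → 0ℚ ≤ x → 0ℚ ≤ n · x
·-nonneg zero    0≤x = ≤-refl
·-nonneg (suc n) 0≤x = 0≤+ 0≤x (·-nonneg n 0≤x)

·-monoʳ : ∀ n {x y} → x ≤ y → n · x ≤ n · y
·-monoʳ zero    x≤y = ≤-refl
·-monoʳ (suc n) x≤y = +-mono-≤ x≤y (·-monoʳ n x≤y)

·-monoˡ : ∀ {m n x} → 0ℚ ≤ x → m ℕ.≤ n → m · x ≤ n · x
·-monoˡ {m} {n} {x} 0≤x m≤n = begin
  m · x                   ≡⟨ +-identityʳ (m · x) ⟨
  m · x + 0ℚ              ≤⟨ +-monoʳ-≤ (m · x) (·-nonneg (n ℕ.∸ m) 0≤x) ⟩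
  m · x + (n ℕ.∸ m) · x   ≡⟨ ×-homo-+ x m (n ℕ.∸ m) ⟨
  (m ℕ.+ (n ℕ.∸ m)) · x   ≡⟨ cong (_· x) (ℕP.m+[n∸m]≡n m≤n) ⟩
  n · x                   ∎
  where open ≤-Reasoning

-- (n+1) copies of 1/(n+1) make 1; computed on unnormalised fractions k/(n+1).
·-inv : ∀ n → suc n · inv n ≡ 1ℚ
·-inv n = toℚᵘ-injective (ℚᵘP.≃-trans (multiple (suc n)) (ℚᵘ.*≡* (ℤP.*-comm (+ suc n) (+ 1))))
  where
  multiple : ∀ k → toℚᵘ (k · inv n) ℚᵘ.≃ ℚᵘ.mkℚᵘ (+ k) n
  multiple zero    = ℚᵘ.*≡* refl
  multiple (suc k) = ℚᵘP.≃-trans (toℚᵘ-homo-+ (inv n) (k · inv n))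
    (ℚᵘP.≃-trans (ℚᵘP.+-cong (toℚᵘ-fromℚᵘ (ℚᵘ.mkℚᵘ (+ 1) n)) (multiple k))
                 (ℚᵘ.*≡* (same-denominator (+ k) (+ suc n))))
    where
    same-denominator : ∀ k D → (+ 1 ℤ.* D ℤ.+ k ℤ.* D) ℤ.* D ≡ (+ 1 ℤ.+ k) ℤ.* (D ℤ.* D)
    same-denominator k D =
      trans (cong (ℤ._* D) (sym (ℤP.*-distribʳ-+ D (+ 1) k))) (ℤP.*-assoc (+ 1 ℤ.+ k) D D)

inv-pos : ∀ n → 0ℚ < inv n
inv-pos n = positive⁻¹ (inv n) {{normalize-pos 1 (suc n)}}

≤-inv : ∀ n {z} → suc n · z ≤ 1ℚ → z ≤ inv n
≤-inv n {z} bound with z ≤? inv n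
... | yes z≤inv = z≤inv
... | no  z≰inv = ⊥-elim (<-irrefl refl (<-≤-trans 1<[n+1]·z bound))
  where
  open ≤-Reasoning
  inv<z : inv n < z
  inv<z = ≰⇒> z≰inv
  1<[n+1]·z : 1ℚ < suc n · z
  1<[n+1]·z = begin-strict
    1ℚ              ≡⟨ ·-inv n ⟨
    suc n · inv n   <⟨ +-mono-<-≤ inv<z (·-monoʳ n (<⇒≤ inv<z)) ⟩
    suc n · z       ∎

archimedean : ∀ {ε} → 0ℚ < ε → ∃[ n ] (inv n < ε)
archimedean {mkℚ +[1+ p ] q _} _ = suc q , toℚᵘ-cancel-<
  (ℚᵘP.<-respˡ-≃ (ℚᵘP.≃-sym (toℚᵘ-fromℚᵘ (ℚᵘ.mkℚᵘ (+ 1) (suc q))))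
    (ℚᵘ.*<* (ℤ.+<+ (s≤s (s≤s (ℕP.+-monoʳ-≤ q z≤n))))))
archimedean {mkℚ (+ zero) q _} (*<* (ℤ.+<+ ()))
archimedean {mkℚ ℤ.-[1+ p ] q _} (*<* ())

pow-nonneg : ∀ n {x} → 0ℚ ≤ x → 0ℚ ≤ x ^ n
pow-nonneg zero    0≤x = 0≤1
pow-nonneg (suc n) 0≤x = 0≤* 0≤x (pow-nonneg n 0≤x)

pow-pos : ∀ n {x} → 0ℚ < x → 0ℚ < x ^ n
pow-pos zero    0<x = 0<1
pow-pos (suc n) 0<x = 0<* 0<x (pow-pos n 0<x)

shrink : ∀ {r p} → 0ℚ ≤ p → r ≤ 1ℚ → r * p ≤ p
shrink {r} {p} 0≤p r≤1 = subst (r * p ≤_) (*-identityˡ p) (*-monoʳ-≤-nonNeg p {{nonNegative 0≤p}} r≤1)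

pow-≤1 : ∀ n {x} → 0ℚ ≤ x → x ≤ 1ℚ → x ^ n ≤ 1ℚ
pow-≤1 zero    0≤x x≤1 = ≤-refl
pow-≤1 (suc n) 0≤x x≤1 = ≤-trans (shrink (pow-nonneg n 0≤x) x≤1) (pow-≤1 n 0≤x x≤1)

pow-suc-≤ : ∀ n {x} → 0ℚ ≤ x → x ≤ 1ℚ → x ^ suc n ≤ x
pow-suc-≤ n {x} 0≤x x≤1 = subst (x * (x ^ n) ≤_) (*-identityʳ x) (*-monoˡ 0≤x (pow-≤1 n 0≤x x≤1))

pow-suc-difference : ∀ x y xⁿ yⁿ → y * yⁿ - x * xⁿ ≡ y * (yⁿ - xⁿ) + (y - x) * xⁿ
pow-suc-difference = solve-∀ ℚ-ring

pow-mono : ∀ n {x y} → 0ℚ ≤ x → x ≤ y → x ^ n ≤ y ^ n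
pow-mono zero    0≤x x≤y = ≤-refl
pow-mono (suc n) {x} {y} 0≤x x≤y = ≤-by _ (pow-suc-difference x y (x ^ n) (y ^ n))
  (0≤+ (0≤* (≤-trans 0≤x x≤y) (0≤q-p (pow-mono n 0≤x x≤y))) (0≤* (0≤q-p x≤y) (pow-nonneg n 0≤x)))

pow-lipschitz : ∀ n {x y} → 0ℚ ≤ x → x ≤ y → y ≤ 1ℚ → y ^ n - x ^ n ≤ n · (y - x)
pow-lipschitz zero    {x} {y} 0≤x x≤y y≤1 = ≤-reflexive (+-inverseʳ 1ℚ)
pow-lipschitz (suc n) {x} {y} 0≤x x≤y y≤1 = begin
  y ^ suc n - x ^ suc n                 ≡⟨ pow-suc-difference x y (x ^ n) (y ^ n) ⟩
  y * (y ^ n - x ^ n) + (y - x) * x ^ n ≤⟨ +-mono-≤ (shrink (0≤q-p (pow-mono n 0≤x x≤y)) y≤1)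
                                                    (subst ((y - x) * x ^ n ≤_) (*-identityʳ (y - x))
                                                      (*-monoˡ (0≤q-p x≤y) (pow-≤1 n 0≤x (≤-trans x≤y y≤1)))) ⟩
  (y ^ n - x ^ n) + (y - x)             ≤⟨ +-monoˡ-≤ (y - x) (pow-lipschitz n 0≤x x≤y y≤1) ⟩
  n · (y - x) + (y - x)                 ≡⟨ +-comm (n · (y - x)) (y - x) ⟩
  suc n · (y - x)                       ∎
  where open ≤-Reasoning

bernoulli : ∀ n {x} → 0ℚ ≤ x → x ≤ 1ℚ → 1ℚ - n · x ≤ (1ℚ - x) ^ n
bernoulli zero    0≤x x≤1 = ≤-refl
bernoulli (suc n) {x} 0≤x x≤1 = begin
  1ℚ - (x + n · x)           ≤⟨ ≤-by _ (product-excess x (n · x)) (0≤* 0≤x (·-nonneg n 0≤x)) ⟩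
  (1ℚ - x) * (1ℚ - n · x)    ≤⟨ *-monoˡ (0≤q-p x≤1) (bernoulli n 0≤x x≤1) ⟩
  (1ℚ - x) * (1ℚ - x) ^ n    ∎
  where
  open ≤-Reasoning
  product-excess : ∀ x r → (1ℚ - x) * (1ℚ - r) - (1ℚ - (x + r)) ≡ x * r
  product-excess = solve-∀ ℚ-ring

½≤1 : ½ ≤ 1ℚ
½≤1 = *≤* (ℤ.+≤+ (s≤s z≤n))

½^≤1 : ∀ n → ½ ^ n ≤ 1ℚ
½^≤1 n = pow-≤1 n 0≤½ ½≤1

halving : ∀ k n → k · (½ ^ n) ≤ 1ℚ → suc k · (½ ^ suc n) ≤ 1ℚ
halving k n bound = begin
  suc k · (½ * ½ ^ n)     ≡⟨ ×-comm-* (suc k) ½ (½ ^ n) ⟨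
  ½ * (suc k · (½ ^ n))   ≤⟨ *-monoˡ 0≤½ (+-mono-≤ (½^≤1 n) bound) ⟩
  ½ * (1ℚ + 1ℚ)           ≡⟨⟩
  1ℚ                      ∎
  where open ≤-Reasoning

½^-bound : ∀ n → suc n · (½ ^ n) ≤ 1ℚ
½^-bound zero    = ≤-refl
½^-bound (suc n) = halving (suc n) n (½^-bound n)

½^≤inv : ∀ n → ½ ^ n ≤ inv n
½^≤inv n = ≤-inv n (½^-bound n)

½^-bound₂ : ∀ e → (4 ℕ.+ e) · (½ ^ (2 ℕ.+ e)) ≤ 1ℚ
½^-bound₂ zero    = ≤-refl
½^-bound₂ (suc e) = halving (4 ℕ.+ e) (2 ℕ.+ e) (½^-bound₂ e)

-- Halving the interval n times, always keeping
-- the half across which g changes sign, gives nested brackets of width ≤ ½ⁿ;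
-- their left ends form a regular Cauchy sequence, i.e. a constructive real,
-- and |g| at the n-th left end is at most L ½ⁿ, so that real is a root of g.
module Bisection (g : ℚ → ℚ) (L : ℕ) {a b : ℚ} (a≤b : a ≤ b) (b-a≤1 : b - a ≤ 1ℚ)
                 (ga≤0 : g a ≤ 0ℚ) (0≤gb : 0ℚ ≤ g b)
                 (lipschitz : ∀ {x y} → a ≤ x → x ≤ y → y ≤ b → g y - g x ≤ L · (y - x))
                 where

  record Bracket (n : ℕ) : Set where
    field
      lo hi : ℚ
      lo≤hi : lo ≤ hi
      g-lo  : g lo ≤ 0ℚ
      g-hi  : 0ℚ ≤ g hi
      width : hi - lo ≤ ½ ^ n
  open Bracket

  module Halves {n} (I : Bracket n) where
    mid : ℚ
    mid = ½ * (lo I + hi I)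

    half-width : hi I - mid ≡ ½ * (hi I - lo I) × mid - lo I ≡ ½ * (hi I - lo I)
    half-width = upper-half (lo I) (hi I) , lower-half (lo I) (hi I)
      where
      upper-half : ∀ l h → h - ½ * (l + h) ≡ ½ * (h - l)
      upper-half = solve-∀ ℚ-ring
      lower-half : ∀ l h → ½ * (l + h) - l ≡ ½ * (h - l)
      lower-half = solve-∀ ℚ-ring

    0≤half : 0ℚ ≤ ½ * (hi I - lo I)
    0≤half = 0≤* 0≤½ (0≤q-p (lo≤hi I))

    half≤ : ½ * (hi I - lo I) ≤ ½ ^ suc n
    half≤ = *-monoˡ 0≤½ (width I)

    lo≤mid : lo I ≤ mid
    lo≤mid = ≤-by _ (proj₂ half-width) 0≤half

    mid≤hi : mid ≤ hi I
    mid≤hi = ≤-by _ (proj₁ half-width) 0≤half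

  open Halves

  halve : ∀ {n} → Bracket n → Bracket (suc n)
  halve {n} I with g (mid I) ≤? 0ℚ
  ... | yes g-mid≤0 = record
    { lo = mid I ; hi = hi I ; lo≤hi = mid≤hi I ; g-lo = g-mid≤0 ; g-hi = g-hi I
    ; width = subst (_≤ ½ ^ suc n) (sym (proj₁ (half-width I))) (half≤ I) }
  ... | no  g-mid≰0 = record
    { lo = lo I ; hi = mid I ; lo≤hi = lo≤mid I ; g-lo = g-lo I ; g-hi = <⇒≤ (≰⇒> g-mid≰0)
    ; width = subst (_≤ ½ ^ suc n) (sym (proj₂ (half-width I))) (half≤ I) }

  halve-nested : ∀ {n} (I : Bracket n) → lo I ≤ lo (halve I) × hi (halve I) ≤ hi I
  halve-nested I with g (mid I) ≤? 0ℚ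
  ... | yes _ = lo≤mid I , ≤-refl
  ... | no  _ = ≤-refl , mid≤hi I

  bracket : ∀ n → Bracket n
  bracket zero    = record { lo = a ; hi = b ; lo≤hi = a≤b ; g-lo = ga≤0 ; g-hi = 0≤gb ; width = b-a≤1 }
  bracket (suc n) = halve (bracket n)

  left right : ℕ → ℚ
  left  n = lo (bracket n)
  right n = hi (bracket n)

  nested : ∀ {m n} → m ≤′ n → left m ≤ left n × right n ≤ right m
  nested ≤′-refl         = ≤-refl , ≤-refl
  nested (≤′-step m≤′n) =
    ≤-trans (proj₁ (nested m≤′n)) (proj₁ (halve-nested (bracket _))) ,
    ≤-trans (proj₂ (halve-nested (bracket _))) (proj₂ (nested m≤′n))

  within : ∀ n → a ≤ left n × right n ≤ b
  within n = nested {0} {n} (ℕP.≤⇒≤′ z≤n)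

  -- later left ends stay inside an earlier bracket
  left-gap : ∀ {m n} → m ℕ.≤ n → left n - left m ≤ inv m
  left-gap {m} {n} m≤n = begin
    left n - left m    ≤⟨ +-monoˡ-≤ (- left m) (≤-trans (lo≤hi (bracket n)) right-n≤right-m) ⟩
    right m - left m   ≤⟨ width (bracket m) ⟩
    ½ ^ m              ≤⟨ ½^≤inv m ⟩
    inv m              ∎
    where
    open ≤-Reasoning
    right-n≤right-m : right n ≤ right m
    right-n≤right-m = proj₂ (nested (ℕP.≤⇒≤′ m≤n))

  regular : ∀ m n → ∣ left m - left n ∣ ≤ inv m + inv n
  regular m n with ℕP.≤-total m n
  ... | inj₁ m≤n = begin
    ∣ left m - left n ∣  ≡⟨ dist-ordered (proj₁ (nested (ℕP.≤⇒≤′ m≤n))) ⟩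
    left n - left m      ≤⟨ left-gap m≤n ⟩
    inv m                ≤⟨ p≤p+q (<⇒≤ (inv-pos n)) ⟩
    inv m + inv n        ∎
    where open ≤-Reasoning
  ... | inj₂ n≤m = begin
    ∣ left m - left n ∣  ≡⟨ 0≤p⇒∣p∣≡p (0≤q-p (proj₁ (nested (ℕP.≤⇒≤′ n≤m)))) ⟩
    left m - left n      ≤⟨ left-gap n≤m ⟩
    inv n                ≤⟨ p≤q+p (<⇒≤ (inv-pos m)) ⟩
    inv m + inv n        ∎
    where open ≤-Reasoning

  root : ℝ
  root = record { seq = left ; reg = regular }

  -- |g| at the n-th left end is bounded by the sign change across the bracket
  residual : ∀ n → ∣ g (left n) ∣ ≤ L · (½ ^ n)
  residual n = begin
    ∣ g l ∣            ≡⟨ ∣-p∣≡∣p∣ (g l) ⟨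
    ∣ - g l ∣          ≡⟨ 0≤p⇒∣p∣≡p (neg-antimono-≤ (g-lo I)) ⟩
    - g l              ≤⟨ p≤q+p (g-hi I) ⟩
    g r - g l          ≤⟨ lipschitz (proj₁ (within n)) (lo≤hi I) (proj₂ (within n)) ⟩
    L · (r - l)        ≤⟨ ·-monoʳ L (width I) ⟩
    L · (½ ^ n)        ∎
    where
    open ≤-Reasoning
    I : Bracket n
    I = bracket n
    l r : ℚ
    l = left n
    r = right n

  root-is-root : IsRoot g root
  root-is-root k = suc k ℕ.* L , λ n N≤n → ≤-trans (residual n) (≤-inv k (begin
    suc k · (L · (½ ^ n))    ≡⟨ ×-assocˡ (½ ^ n) (suc k) L ⟩
    (suc k ℕ.* L) · (½ ^ n)  ≤⟨ ·-monoˡ (pow-nonneg n 0≤½) (ℕP.m≤n⇒m≤1+n N≤n) ⟩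
    suc n · (½ ^ n)          ≤⟨ ½^-bound n ⟩
    1ℚ                       ∎))
    where open ≤-Reasoning

  intermediate-value : ∃[ r ] (IsRoot g r × (∀ n → a ≤ seq r n) × (∀ n → seq r n ≤ b))
  intermediate-value = root , root-is-root , (λ n → proj₁ (within n))
                     , (λ n → ≤-trans (lo≤hi (bracket n)) (proj₂ (within n)))

<ᴿ-from-bound : ∀ {a c} (x : ℝ) → 0ℚ < c - a → (∀ n → c ≤ seq x n) → a <ᴿ x
<ᴿ-from-bound {a} x margin bound =
  let (n , inv<margin) = archimedean margin
  in n , <-≤-trans inv<margin (+-monoˡ-≤ (- a) (bound n))

ᴿ<-from-bound : ∀ {b c} (x : ℝ) → 0ℚ < b - c → (∀ n → seq x n ≤ c) → x ᴿ< b
ᴿ<-from-bound {b} x margin bound =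
  let (n , inv<margin) = archimedean margin
  in n , <-≤-trans inv<margin (+-monoʳ-≤ b (neg-antimono-≤ (bound n)))

-- The polynomial of the paper with μ as a free parameter m, so that f σ = F (μ σ):
-- F m d x = x^(d+1) - x^d - m^(d+1) + m^d.
F : ℚ → ℕ → ℚ → ℚ
F m d x = (((x ^ suc d) - (x ^ d)) - (m ^ suc d)) + (m ^ d)

-- On [0,1] the polynomial F m d increases by at most (d+1)(y - x) from x to y,
-- since its decreasing part -x^d only helps.
F-lipschitz : ∀ m d {x y} → 0ℚ ≤ x → x ≤ y → y ≤ 1ℚ → F m d y - F m d x ≤ suc d · (y - x)
F-lipschitz m d {x} {y} 0≤x x≤y y≤1 = begin
  F m d y - F m d x                          ≡⟨ constants-cancel y x (y ^ d) (x ^ d) (m ^ suc d) (m ^ d) ⟩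
  (y ^ suc d - x ^ suc d) - (y ^ d - x ^ d)  ≤⟨ p-q≤p (0≤q-p (pow-mono d 0≤x x≤y)) ⟩
  y ^ suc d - x ^ suc d                      ≤⟨ pow-lipschitz (suc d) 0≤x x≤y y≤1 ⟩
  suc d · (y - x)                            ∎
  where
  open ≤-Reasoning
  constants-cancel : ∀ y x yᵈ xᵈ M₁ M₀ →
    (((y * yᵈ - yᵈ) - M₁) + M₀) - (((x * xᵈ - xᵈ) - M₁) + M₀) ≡ (y * yᵈ - x * xᵈ) - (yᵈ - xᵈ)
  constants-cancel = solve-∀ ℚ-ring

-- Then 1 - mᵈ < A ≤ B < 1 - mᵈ⁺¹, F(A) ≤ 0 (by Bernoulli, Aᵈ ≥ 1 - d t) and
-- F(B) ≥ 0 (since Bᵈ ≤ B), so bisection on [A, B] produces the root.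
module Window (m : ℚ) (0<m : 0ℚ < m) (m+m≤1 : m + m ≤ 1ℚ) (j : ℕ)
              (small : suc j · (m ^ suc j) ≤ ½ * m) where

  d : ℕ
  d = suc j

  t c u s A B : ℚ
  t = m ^ d
  c = 1ℚ - ½ * m
  u = m * t
  s = u + u * u
  A = 1ℚ - c * t
  B = 1ℚ - s

  -- Polynomial identities in the free variables behind the window; each
  -- rewrites a quantity whose sign we need as a manifestly signed expression.
  c-split : ∀ m → 1ℚ - ½ * m ≡ (½ + ½ * (1ℚ - (m + m))) + ½ * m
  c-split = solve-∀ ℚ-ring

  B-split : ∀ u → 1ℚ - (u + u * u) ≡ (1ℚ - (u + u)) + u * ((1ℚ - (u + u)) + u)
  B-split = solve-∀ ℚ-ring

  B-A-split : ∀ m t → (1ℚ - (m * t + (m * t) * (m * t))) - (1ℚ - (1ℚ - ½ * m) * t)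
                       ≡ t * (1ℚ - (m + m)) + (½ * (m * t)) * (1ℚ - (m * t + m * t))
  B-A-split = solve-∀ ℚ-ring

  F-at-A : ∀ m t P → ((((1ℚ - (1ℚ - ½ * m) * t) * P) - P) - m * t) + t
                      ≡ - (t * ((1ℚ - ½ * m) * P - (1ℚ - m)))
  F-at-A = solve-∀ ℚ-ring

  cP-split : ∀ m P r → (1ℚ - ½ * m) * P - (1ℚ - m)
                        ≡ (1ℚ - ½ * m) * (P - (1ℚ - r)) + ((½ * m - r) + (½ * m) * r)
  cP-split = solve-∀ ℚ-ring

  F-at-B : ∀ u t Q → ((((1ℚ - (u + u * u)) * Q) - Q) - u) + t
                      ≡ (u + u * u) * ((1ℚ - (u + u * u)) - Q)
                        + ((t - (u + u)) + ((u * u * u + u * u * u) + (u * u) * (u * u)))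
  F-at-B = solve-∀ ℚ-ring

  lower-split : ∀ m t → (1ℚ - (1ℚ - ½ * m) * t) - (1ℚ - t) ≡ (½ * m) * t
  lower-split = solve-∀ ℚ-ring

  upper-split : ∀ u → (1ℚ - u) - (1ℚ - (u + u * u)) ≡ u * u
  upper-split = solve-∀ ℚ-ring

  0≤m : 0ℚ ≤ m
  0≤m = <⇒≤ 0<m

  0≤½m : 0ℚ ≤ ½ * m
  0≤½m = 0≤* 0≤½ 0≤m

  0≤1-2m : 0ℚ ≤ 1ℚ - (m + m)
  0≤1-2m = 0≤q-p m+m≤1

  m≤1 : m ≤ 1ℚ
  m≤1 = ≤-trans (p≤p+q 0≤m) m+m≤1

  0<t : 0ℚ < t
  0<t = pow-pos d 0<m

  0≤t : 0ℚ ≤ t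
  0≤t = <⇒≤ 0<t

  t≤1 : t ≤ 1ℚ
  t≤1 = pow-≤1 d 0≤m m≤1

  0≤c : 0ℚ ≤ c
  0≤c = subst (0ℚ ≤_) (sym (c-split m)) (0≤+ (0≤+ 0≤½ (0≤* 0≤½ 0≤1-2m)) 0≤½m)

  c≤1 : c ≤ 1ℚ
  c≤1 = p-q≤p 0≤½m

  ct≤t : c * t ≤ t
  ct≤t = shrink 0≤t c≤1

  0≤u : 0ℚ ≤ u
  0≤u = 0≤* 0≤m 0≤t

  0<u : 0ℚ < u
  0<u = 0<* 0<m 0<t

  0≤s : 0ℚ ≤ s
  0≤s = 0≤+ 0≤u (0≤* 0≤u 0≤u)

  0≤1-2u : 0ℚ ≤ 1ℚ - (u + u)
  0≤1-2u = 0≤q-p (≤-trans (+-mono-≤ u≤m u≤m) m+m≤1)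
    where
    u≤m : u ≤ m
    u≤m = subst (u ≤_) (*-identityʳ m) (*-monoˡ 0≤m t≤1)

  0≤A : 0ℚ ≤ A
  0≤A = 0≤q-p (≤-trans ct≤t t≤1)

  0≤B : 0ℚ ≤ B
  0≤B = subst (0ℚ ≤_) (sym (B-split u)) (0≤+ 0≤1-2u (0≤* 0≤u (0≤+ 0≤1-2u 0≤u)))

  B≤1 : B ≤ 1ℚ
  B≤1 = p-q≤p 0≤s

  A≤B : A ≤ B
  A≤B = ≤-by _ (B-A-split m t) (0≤+ (0≤* 0≤t 0≤1-2m) (0≤* (0≤* 0≤½ 0≤u) 0≤1-2u))

  B-A≤1 : B - A ≤ 1ℚ
  B-A≤1 = ≤-trans (p-q≤p 0≤A) B≤1

  -- Bernoulli: Aᵈ = (1 - c t)ᵈ ≥ 1 - d c t ≥ 1 - d t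
  Aᵈ-bound : 1ℚ - d · t ≤ A ^ d
  Aᵈ-bound = ≤-trans (+-monoʳ-≤ 1ℚ (neg-antimono-≤ (·-monoʳ d ct≤t)))
                     (bernoulli d (0≤* 0≤c 0≤t) (≤-trans ct≤t t≤1))

  -- F(A) = -t (c Aᵈ - (1 - m)), and c Aᵈ ≥ c (1 - d t) ≥ 1 - m because d t ≤ m/2
  F[A]≤0 : F m d A ≤ 0ℚ
  F[A]≤0 = subst (_≤ 0ℚ) (sym (F-at-A m t (A ^ d))) (neg-antimono-≤ (0≤* 0≤t 0≤cAᵈ-[1-m]))
    where
    0≤cAᵈ-[1-m] : 0ℚ ≤ c * A ^ d - (1ℚ - m)
    0≤cAᵈ-[1-m] = subst (0ℚ ≤_) (sym (cP-split m (A ^ d) (d · t)))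
      (0≤+ (0≤* 0≤c (0≤q-p Aᵈ-bound)) (0≤+ (0≤q-p small) (0≤* 0≤½m (·-nonneg d 0≤t))))

  -- F(B) = s (B - Bᵈ) + (t - 2u) + 2u³ + u⁴ with Bᵈ ≤ B and 2u ≤ 2m t ≤ t
  0≤F[B] : 0ℚ ≤ F m d B
  0≤F[B] = subst (0ℚ ≤_) (sym (F-at-B u t (B ^ d)))
    (0≤+ (0≤* 0≤s (0≤q-p (pow-suc-≤ j 0≤B B≤1)))
         (0≤+ 0≤t-2u (0≤+ (0≤+ 0≤u³ 0≤u³) (0≤* (0≤* 0≤u 0≤u) (0≤* 0≤u 0≤u)))))
    where
    0≤u³ : 0ℚ ≤ u * u * u
    0≤u³ = 0≤* (0≤* 0≤u 0≤u) 0≤u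
    t-2u-split : ∀ m t → t - (m * t + m * t) ≡ t * (1ℚ - (m + m))
    t-2u-split = solve-∀ ℚ-ring
    0≤t-2u : 0ℚ ≤ t - (u + u)
    0≤t-2u = subst (0ℚ ≤_) (sym (t-2u-split m t)) (0≤* 0≤t 0≤1-2m)

  lower-margin : 0ℚ < A - (1ℚ - m ^ d)
  lower-margin = subst (0ℚ <_) (sym (lower-split m t)) (0<* (0<* (inv-pos 1) 0<m) 0<t)

  upper-margin : 0ℚ < (1ℚ - m ^ suc d) - B
  upper-margin = subst (0ℚ <_) (sym (upper-split u)) (0<* 0<u 0<u)

  root-in-window : ∃[ λ₀ ] (IsRoot (F m d) λ₀ × ((1ℚ - (m ^ d)) <ᴿ λ₀) × (λ₀ ᴿ< (1ℚ - (m ^ suc d))))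
  root-in-window =
    let (λ₀ , is-root , A≤λ₀ , λ₀≤B) =
          Bisection.intermediate-value (F m d) (suc d) A≤B B-A≤1 F[A]≤0 0≤F[B]
            (λ A≤x x≤y y≤B → F-lipschitz m d (≤-trans 0≤A A≤x) x≤y (≤-trans y≤B B≤1))
    in λ₀ , is-root , <ᴿ-from-bound λ₀ lower-margin A≤λ₀
          , ᴿ<-from-bound {b = 1ℚ - m ^ suc d} λ₀ upper-margin λ₀≤B

-- For 0 ≤ m ≤ ½ and d ≥ 4:  d mᵈ ≤ d m (½)ᵈ⁻¹ = (m/2) · d (½)ᵈ⁻² ≤ m/2.
power-small : ∀ {m} → 0ℚ ≤ m → m + m ≤ 1ℚ → ∀ e → (4 ℕ.+ e) · (m ^ (4 ℕ.+ e)) ≤ ½ * m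
power-small {m} 0≤m m+m≤1 e = begin
  n · (m * m ^ (3 ℕ.+ e))           ≤⟨ ·-monoʳ n (*-monoˡ 0≤m (pow-mono (3 ℕ.+ e) 0≤m m≤½)) ⟩
  n · (m * (½ * h))                 ≡⟨ cong (n ·_) (*-assoc m ½ h) ⟨
  n · ((m * ½) * h)                 ≡⟨ ×-comm-* n (m * ½) h ⟨
  (m * ½) * (n · h)                 ≤⟨ *-monoˡ (0≤* 0≤m 0≤½) (½^-bound₂ e) ⟩
  (m * ½) * 1ℚ                      ≡⟨ trans (*-identityʳ (m * ½)) (*-comm m ½) ⟩
  ½ * m                             ∎
  where
  open ≤-Reasoning
  n : ℕ
  n = 4 ℕ.+ e
  h : ℚ
  h = ½ ^ (2 ℕ.+ e)
  half-double : ∀ m → ½ * (m + m) ≡ m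
  half-double = solve-∀ ℚ-ring
  m≤½ : m ≤ ½
  m≤½ = subst₂ _≤_ (half-double m) (*-identityʳ ½) (*-monoˡ 0≤½ m+m≤1)

root-near-one : ∀ {m} → 0ℚ < m → m + m ≤ 1ℚ → ∀ d → 4 ℕ.≤ d →
  ∃[ λ₀ ] (IsRoot (F m d) λ₀ × ((1ℚ - (m ^ d)) <ᴿ λ₀) × (λ₀ ᴿ< (1ℚ - (m ^ suc d))))
root-near-one {m} 0<m m+m≤1 (suc (suc (suc (suc e)))) (s≤s (s≤s (s≤s (s≤s _)))) =
  Window.root-in-window m 0<m m+m≤1 (3 ℕ.+ e) (power-small (<⇒≤ 0<m) m+m≤1 e)

μ-pos : ∀ k → 0ℚ < μ (suc (suc k))
μ-pos k = inv-pos (suc k)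

μ+μ≤1 : ∀ k → μ (suc (suc k)) + μ (suc (suc k)) ≤ 1ℚ
μ+μ≤1 k = begin
  m + m                ≡⟨ cong (_+_ m) (+-identityʳ m) ⟨
  2 · m                ≤⟨ ·-monoˡ {2} {suc (suc k)} (<⇒≤ (μ-pos k)) (s≤s (s≤s z≤n)) ⟩
  suc (suc k) · m      ≡⟨ ·-inv (suc k) ⟩
  1ℚ                   ∎
  where
  open ≤-Reasoning
  m : ℚ
  m = μ (suc (suc k))

lemma5 : (σ : ℕ) → 2 ℕ.≤ σ →
    ∃[ D ] (∀ d → D ℕ.≤ d →
    ∃[ λ₀ ] (IsRoot (f σ d) λ₀ × ((1ℚ - (μ σ ^ d)) <ᴿ λ₀) × (λ₀ ᴿ< (1ℚ - (μ σ ^ suc d)))))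
lemma5 (suc (suc k)) (s≤s (s≤s z≤n)) = 4 , root-near-one (μ-pos k) (μ+μ≤1 k)
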